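{- Let $I=(V,\mathcal{C},k)$ be an irreducible instance of 3-Linear Ordering with $V=\{v_1,\dots,v_n\}$, and let $t=2$. Then every variable $v_i\in V$ is represented in the associated $t$-Ordering instance, i.e. there is a set $S\subseteq[2n]$ with $S\cap\{2i-1,2i\}\ne\emptyset$ and $\hat g(S)\neq 0$.
   Context: 3-Linear Ordering: an instance $(V,\mathcal{C},k)$ consists of a finite variable set $V$, a multiset $\mathcal{C}$ of constraints, each an ordered tuple $e=(e(1),e(2),e(3))$ of three distinct variables or $e=(e(1),e(2))$ of two distinct variables, with integer weight $w(e)\ge0$, and an integer $k\ge0$. A linear ordering $\phi:V\to\{1,\dots,|V|\}$ satisfies $e$ if $\phi(e(1))<\phi(e(2))<\phi(e(3))$ (resp. $\phi(e(1))<\phi(e(2))$). Irreducible means none of these rules applies: (Redundancy) some variable appears in no constraint, or some constraint has weight $0$; (Merging) two identical constraints occur; (Cancellation) there are binary $e_1,e_2$ with $e_2=(e_1(2),e_1(1))$; (Edge Replacement) there are ternary $e_1,e_2,e_3$ with $e_2=(e_1(2),e_1(1),e_1(3))$, $e_3=(e_1(1),e_1(3),e_1(2))$; (Cycle Replacement) there are ternary $e_1,e_2,e_3$ with $e_2=(e_1(2),e_1(3),e_1(1))$, $e_3=(e_1(3),e_1(1),e_1(2))$. Associated $t$-Ordering instance ($t=2$): a $t$-ordering is a map $\phi_t:V\to\{1,-1\}^t$; vectors in $\{1,-1\}^t$ ("buckets") are totally ordered lexicographically with $+1<-1$. For a constraint $e$ of arity $r\in\{2,3\}$, define $g_e:(\{1,-1\}^t)^r\to[0,1]$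 sending the bucket vectors of $e(1),\dots,e(r)$ to the probability that a uniformly random linear ordering $\phi$ with $\phi(u)<\phi(v)$ whenever the bucket of $u$ is smaller than that of $v$ satisfies $e$. Encode $\phi_t$ by $x\in\{1,-1\}^{2n}$ with $(x_{2i-1},x_{2i})=\phi_t(v_i)$, and let $g(x)=\sum_{e\in\mathcal{C}}w(e)\,g_e(x)$ where $g_e$ is applied to the coordinates of the variables of $e$ in order. Write the unique multilinear (Fourier) expansion $g(x)=\sum_{S\subseteq[2n]}\hat g(S)\prod_{j\in S}x_j$. -}

module Defs where

open import Data.Nat as ℕ using (ℕ; zero; suc; _^_; _<ᵇ_)
open import Data.Nat.Properties using (m^n≢0)
open import Data.Integer using (+_)
open import Data.Fin using (Fin)
open import Data.Bool using (Bool; true; false; not; _∨_; _∧_; if_then_else_)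
open import Data.Product using (_×_; _,_; proj₁; proj₂; ∃-syntax)
open import Data.Sum using (_⊎_)
open import Data.Empty using (⊥)
open import Data.List as List using (List; []; _∷_; concatMap; length)
open import Data.List.Membership.Propositional using (_∈_)
open import Data.List.Relation.Unary.All using (All)
open import Data.Vec as Vec using (Vec; []; _∷_)
open import Data.Rational using (ℚ; 0ℚ; 1ℚ; _+_; _*_; -_; _/_)
open import Relation.Binary.PropositionalEquality using (_≡_; _≢_)

-- Instances of 3-Linear Ordering on the variable set V = Fin n
-- (variable v_i is the index i-1 : Fin n)

data Tuple (n : ℕ) : Set where
  bin  : Fin n → Fin n → Tuple n
  tern : Fin n → Fin n → Fin n → Tuple n

Distinct : ∀ {n} → Tuple n → Set
Distinct (bin a b)    = a ≢ b
Distinct (tern a b c) = a ≢ b × a ≢ c × b ≢ c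

Occurs : ∀ {n} → Fin n → Tuple n → Set
Occurs v (bin a b)    = v ≡ a ⊎ v ≡ b
Occurs v (tern a b c) = v ≡ a ⊎ v ≡ b ⊎ v ≡ c

record Constraint (n : ℕ) : Set where
  field
    tuple  : Tuple n
    weight : ℕ
open Constraint public

-- the multiset 𝒞 is represented by a list
record Instance : Set where
  field
    n        : ℕ
    cons     : List (Constraint n)
    k        : ℕ
    distinct : All (λ e → Distinct (tuple e)) cons
open Instance public

tuples : (I : Instance) → List (Tuple (n I))
tuples I = List.map tuple (cons I)

-- Irreducibility: none of the five reduction rules applies

record Irreducible (I : Instance) : Set where
  field
    -- Redundancy
    everyVarOccurs : ∀ (v : Fin (n I)) → ∃[ e ] (e ∈ cons I × Occurs v (tuple e))
    weightsNonzero : All (λ e → weight e ≢ 0) (cons I)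
    noMerging : ∀ (i j : Fin (length (cons I))) → i ≢ j →
                tuple (List.lookup (cons I) i) ≢ tuple (List.lookup (cons I) j)
    noCancellation : ∀ a b → bin a b ∈ tuples I → bin b a ∈ tuples I → ⊥
    noEdgeReplacement : ∀ a b c → tern a b c ∈ tuples I →
                        tern b a c ∈ tuples I → tern a c b ∈ tuples I → ⊥
    noCycleReplacement : ∀ a b c → tern a b c ∈ tuples I →
                         tern b c a ∈ tuples I → tern c a b ∈ tuples I → ⊥

-- t-Ordering with t = 2: buckets in {1,-1}^2, lexicographic with +1 < -1

data Sign : Set where
  pos neg : Sign

signVal : Sign → ℚ
signVal pos = 1ℚ
signVal neg = - 1ℚ

sign< : Sign → Sign → Bool
sign< pos neg = true
sign< _   _   = false

sameSign : Sign → Sign → Bool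
sameSign pos pos = true
sameSign neg neg = true
sameSign _   _   = false

Bucket : Set
Bucket = Sign × Sign

bucket< : Bucket → Bucket → Bool
bucket< (a , b) (c , d) = sign< a c ∨ (sameSign a c ∧ sign< b d)

-- g_e : probability that a uniformly random linear ordering respecting the
-- bucket order satisfies e.  By symmetry, the relative order of the r
-- variables of e is then uniform among the r! relative orders respecting
-- the bucket order of those variables; we enumerate these (as rank tuples).

count : {A : Set} → (A → Bool) → List A → ℕ
count p []       = 0
count p (x ∷ xs) = if p x then suc (count p xs) else count p xs

ratio : ℕ → ℕ → ℚ
ratio s zero    = 0ℚ
ratio s (suc m) = (+ s) / suc m

_⇒ᵇ_ : Bool → Bool → Bool
p ⇒ᵇ q = not p ∨ q

respects : Bucket → Bucket → ℕ → ℕ → Bool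
respects bu bv ru rv = (bucket< bu bv ⇒ᵇ (ru <ᵇ rv)) ∧ (bucket< bv bu ⇒ᵇ (rv <ᵇ ru))

ranks2 : List (ℕ × ℕ)
ranks2 = (0 , 1) ∷ (1 , 0) ∷ []

ranks3 : List (ℕ × ℕ × ℕ)
ranks3 = (0 , 1 , 2) ∷ (0 , 2 , 1) ∷ (1 , 0 , 2) ∷ (1 , 2 , 0) ∷ (2 , 0 , 1) ∷ (2 , 1 , 0) ∷ []

prob2 : Bucket → Bucket → ℚ
prob2 b1 b2 = ratio (count (λ { (r1 , r2) → ok r1 r2 ∧ (r1 <ᵇ r2) }) ranks2)
                    (count (λ { (r1 , r2) → ok r1 r2 }) ranks2)
  where ok : ℕ → ℕ → Bool
        ok r1 r2 = respects b1 b2 r1 r2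

prob3 : Bucket → Bucket → Bucket → ℚ
prob3 b1 b2 b3 = ratio (count (λ { (r1 , r2 , r3) → ok r1 r2 r3 ∧ (r1 <ᵇ r2) ∧ (r2 <ᵇ r3) }) ranks3)
                       (count (λ { (r1 , r2 , r3) → ok r1 r2 r3 }) ranks3)
  where ok : ℕ → ℕ → ℕ → Bool
        ok r1 r2 r3 = respects b1 b2 r1 r2 ∧ respects b1 b3 r1 r3 ∧ respects b2 b3 r2 r3

-- A point x ∈ {1,-1}^{2n} is a vector of n buckets: bucket i = (x_{2i-1}, x_{2i}).
Point : ℕ → Set
Point n = Vec Bucket n

gE : ∀ {n} → Point n → Tuple n → ℚ
gE x (bin a b)    = prob2 (Vec.lookup x a) (Vec.lookup x b)
gE x (tern a b c) = prob3 (Vec.lookup x a) (Vec.lookup x b) (Vec.lookup x c)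

sumℚ : List ℚ → ℚ
sumℚ = List.foldr _+_ 0ℚ

g : (I : Instance) → Point (n I) → ℚ
g I x = sumℚ (List.map (λ e → ((+ weight e) / 1) * gE x (tuple e)) (cons I))

-- Fourier coefficients.  A subset S ⊆ [2n] is a vector of n pairs of
-- booleans: component i = (2i-1 ∈ S , 2i ∈ S).

Subset2 : ℕ → Set
Subset2 n = Vec (Bool × Bool) n

allSigns : List Sign
allSigns = pos ∷ neg ∷ []

allBuckets : List Bucket
allBuckets = concatMap (λ a → List.map (a ,_) allSigns) allSigns

allPoints : (n : ℕ) → List (Point n)
allPoints zero    = [] ∷ []
allPoints (suc n) = concatMap (λ b → List.map (b ∷_) (allPoints n)) allBuckets

chi : ∀ {n} → Subset2 n → Point n → ℚ
chi []              []              = 1ℚ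
chi ((s₁ , s₂) ∷ S) ((y₁ , y₂) ∷ x) =
  (if s₁ then signVal y₁ else 1ℚ) * (if s₂ then signVal y₂ else 1ℚ) * chi S x

ghat : (I : Instance) → Subset2 (n I) → ℚ
ghat I S = sumℚ (List.map (λ x → g I x * chi S x) (allPoints (n I)))
           * _/_ (+ 1) (4 ^ n I) {{m^n≢0 4 (n I)}}

-- The character χ_S and the uniform measure on {1,-1}^{2n} both factor over the variables, so the
-- contribution of a constraint e to ĝ(S) is the Fourier sum of its local probability g_e on the
-- buckets of its own variables, times ∏ Σ_y χ_{S_k}(y) over the remaining variables k; that product
-- vanishes as soon as S meets a variable outside e, and is positive otherwise. Taking S nonempty
-- exactly on the variables of one constraint containing v_i, only constraints on a superset of those
-- variables contribute.
-- If v_i lies in a ternary constraint (a,b,c), put the coordinate sets {2k}, {2k-1,2k}, {2k-1} on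
-- a, b, c: then (a,b,c) contributes positively and, among its other orders, only (a,c,b) and
-- (b,c,a) contribute negatively. Edge and cycle replacement forbid one of these to occur together
-- with one of (b,a,c), (c,a,b), which are the negative orders when the same sets are put on b, c, a
-- instead, a choice for which (a,b,c) still contributes positively.
-- Otherwise v_i lies in a binary constraint (a,b) only; the sets {2k-1,2k}, {2k-1} on a, b make
-- (b,a) the only negative contribution, and cancellation excludes it.

module Submission where

open import Defs
open import Data.Bool as Bool using (Bool; true; false; _∨_; _∧_; if_then_else_)
open import Data.Empty using (⊥; ⊥-elim)
open import Data.Fin using (Fin; zero; suc)
open import Data.Fin.Patterns using (0F; 1F; 2F)
open import Data.Fin.Properties using (_≟_)
open import Data.List as List using (List; []; _∷_; _++_; concatMap)
open import Data.List.Properties using (map-cong; map-∘)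
open import Data.List.Membership.Propositional using (find; lose) renaming (_∈_ to _∈ₗ_; _∉_ to _∉ₗ_)
open import Data.List.Membership.Propositional.Properties using () renaming (∈-map⁺ to ∈ₗ-map⁺; ∈-map⁻ to ∈ₗ-map⁻)
import Data.List.Relation.Unary.All as AllL
import Data.List.Relation.Unary.Any as AnyL
open import Data.List.Relation.Unary.Any using (here; there)
open import Data.Nat using (ℕ; zero; suc; _^_)
open import Data.Nat.Properties using (m^n≢0)
open import Data.Integer using () renaming (+_ to ℤ+_)
open import Data.Product using (_×_; _,_; proj₁; proj₂; ∃-syntax)
open import Data.Sum using (_⊎_; inj₁; inj₂)
open import Data.Product.Properties using () renaming (≡-dec to ×-≡-dec)
open import Data.Rational using (ℚ; 0ℚ; 1ℚ; _+_; _*_; _≤_; _<_; _/_; nonNegative; positive)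
import Data.Rational.Properties as ℚP
open import Data.Rational.Solver using (module +-*-Solver)
open import Data.Vec as Vec using (Vec; []; _∷_; lookup; _[_]≔_)
open import Data.Vec.Membership.Propositional using (_∈_; _∉_)
open import Data.Vec.Membership.Propositional.Properties using (∈-lookup; ∈-map⁺)
open import Data.Vec.Properties
  using (tabulate∘lookup; tabulate-cong; ∷-injectiveˡ; ∷-injectiveʳ; lookup-map; lookup∘update; lookup∘update′;
         lookup-replicate)
  renaming (≡-dec to Vec-≡-dec)
open import Data.Vec.Relation.Unary.Any.Properties using (lookup-index)
open import Data.Vec.Relation.Unary.Unique.Propositional.Properties using (lookup-injective)
open import Data.Vec.Relation.Unary.Any using (here; there; any?; index)
import Data.Vec.Relation.Unary.All as All
open All using (All; []; _∷_)
open import Data.Vec.Relation.Unary.Unique.Propositional using (Unique; []; _∷_)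
open import Function using (_∘_)
open import Relation.Nullary.Decidable
  using (Dec; yes; no; does; dec-true; dec-false; toWitness; map′; ¬?; _×-dec_; _⊎-dec_)
open import Relation.Binary.Definitions using (DecidableEquality)
open import Relation.Unary using (Decidable)
open import Relation.Binary.PropositionalEquality
open import Relation.Nullary using (¬_)
open import Algebra.Properties.CommutativeMonoid.Sum ℚP.*-1-commutativeMonoid
  using () renaming (sum to ∏; sum-cong-≗ to ∏-cong)

open +-*-Solver

module _ {A : Set} where

  sumℚ-cong : {f h : A → ℚ} (xs : List A) → (∀ x → f x ≡ h x) →
              sumℚ (List.map f xs) ≡ sumℚ (List.map h xs)
  sumℚ-cong xs eq = cong sumℚ (map-cong eq xs)

  sumℚ-zero : (xs : List A) → sumℚ (List.map (λ _ → 0ℚ) xs) ≡ 0ℚ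
  sumℚ-zero []       = refl
  sumℚ-zero (x ∷ xs) = trans (cong (0ℚ +_) (sumℚ-zero xs)) (ℚP.+-identityʳ 0ℚ)

  sumℚ-+ : (f h : A → ℚ) (xs : List A) →
           sumℚ (List.map (λ x → f x + h x) xs) ≡ sumℚ (List.map f xs) + sumℚ (List.map h xs)
  sumℚ-+ f h []       = sym (ℚP.+-identityʳ 0ℚ)
  sumℚ-+ f h (x ∷ xs) = trans (cong ((f x + h x) +_) (sumℚ-+ f h xs))
    (solve 4 (λ a b c d → (a :+ b) :+ (c :+ d) := (a :+ c) :+ (b :+ d)) refl
           (f x) (h x) (sumℚ (List.map f xs)) (sumℚ (List.map h xs)))

  sumℚ-*ˡ : (c : ℚ) (f : A → ℚ) (xs : List A) →
            sumℚ (List.map (λ x → c * f x) xs) ≡ c * sumℚ (List.map f xs)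
  sumℚ-*ˡ c f []       = sym (ℚP.*-zeroʳ c)
  sumℚ-*ˡ c f (x ∷ xs) = trans (cong (c * f x +_) (sumℚ-*ˡ c f xs)) (sym (ℚP.*-distribˡ-+ c (f x) _))

  sumℚ-*ʳ : (c : ℚ) (f : A → ℚ) (xs : List A) →
            sumℚ (List.map (λ x → f x * c) xs) ≡ sumℚ (List.map f xs) * c
  sumℚ-*ʳ c f []       = sym (ℚP.*-zeroˡ c)
  sumℚ-*ʳ c f (x ∷ xs) = trans (cong (f x * c +_) (sumℚ-*ʳ c f xs)) (sym (ℚP.*-distribʳ-+ c (f x) _))

  sumℚ-++ : (f : A → ℚ) (xs ys : List A) →
            sumℚ (List.map f (xs ++ ys)) ≡ sumℚ (List.map f xs) + sumℚ (List.map f ys)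
  sumℚ-++ f []       ys = sym (ℚP.+-identityˡ _)
  sumℚ-++ f (x ∷ xs) ys = trans (cong (f x +_) (sumℚ-++ f xs ys)) (sym (ℚP.+-assoc (f x) _ _))

  sumℚ-nonneg : (f : A → ℚ) (xs : List A) → (∀ x → x ∈ₗ xs → 0ℚ ≤ f x) → 0ℚ ≤ sumℚ (List.map f xs)
  sumℚ-nonneg f []       h = ℚP.≤-refl
  sumℚ-nonneg f (x ∷ xs) h = ℚP.+-mono-≤ (h x (here refl)) (sumℚ-nonneg f xs (λ y m → h y (there m)))

  sumℚ-pos : (f : A → ℚ) (xs : List A) → (∀ x → x ∈ₗ xs → 0ℚ ≤ f x) →
             ∀ {x₀} → x₀ ∈ₗ xs → 0ℚ < f x₀ → 0ℚ < sumℚ (List.map f xs)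
  sumℚ-pos f (x ∷ xs) h (here refl) p = ℚP.+-mono-<-≤ p (sumℚ-nonneg f xs (λ y m → h y (there m)))
  sumℚ-pos f (x ∷ xs) h (there m₀) p =
    ℚP.+-mono-≤-< (h x (here refl)) (sumℚ-pos f xs (λ y m → h y (there m)) m₀ p)

module _ {A B : Set} where

  sumℚ-swap : (F : A → B → ℚ) (xs : List A) (ys : List B) →
              sumℚ (List.map (λ x → sumℚ (List.map (F x) ys)) xs) ≡
              sumℚ (List.map (λ y → sumℚ (List.map (λ x → F x y) xs)) ys)
  sumℚ-swap F []       ys = sym (sumℚ-zero ys)
  sumℚ-swap F (x ∷ xs) ys = trans (cong (sumℚ (List.map (F x) ys) +_) (sumℚ-swap F xs ys))
                                  (sym (sumℚ-+ (F x) _ ys))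

  sumℚ-concatMap : (G : B → List A) (f : A → ℚ) (bs : List B) →
                   sumℚ (List.map f (concatMap G bs)) ≡ sumℚ (List.map (λ b → sumℚ (List.map f (G b))) bs)
  sumℚ-concatMap G f []       = refl
  sumℚ-concatMap G f (b ∷ bs) = trans (sumℚ-++ f (G b) (concatMap G bs))
                                      (cong (sumℚ (List.map f (G b)) +_) (sumℚ-concatMap G f bs))

0<1 : 0ℚ < 1ℚ
0<1 = toWitness {a? = 0ℚ ℚP.<? 1ℚ} _

*-nonneg : ∀ {p q} → 0ℚ ≤ p → 0ℚ ≤ q → 0ℚ ≤ p * q
*-nonneg {p} {q} 0≤p 0≤q = ℚP.nonNegative⁻¹ (p * q)
  {{ℚP.nonNeg*nonNeg⇒nonNeg p {{nonNegative 0≤p}} q {{nonNegative 0≤q}}}}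

*-pos : ∀ {p q} → 0ℚ < p → 0ℚ < q → 0ℚ < p * q
*-pos {p} {q} 0<p 0<q = ℚP.positive⁻¹ (p * q) {{ℚP.pos*pos⇒pos p {{positive 0<p}} q {{positive 0<q}}}}

∏-nonneg : ∀ {n} (u : Fin n → ℚ) → (∀ k → 0ℚ ≤ u k) → 0ℚ ≤ ∏ u
∏-nonneg {zero}  u h = ℚP.<⇒≤ 0<1
∏-nonneg {suc n} u h = *-nonneg (h zero) (∏-nonneg (u ∘ suc) (h ∘ suc))

∏-pos : ∀ {n} (u : Fin n → ℚ) → (∀ k → 0ℚ < u k) → 0ℚ < ∏ u
∏-pos {zero}  u h = 0<1
∏-pos {suc n} u h = *-pos (h zero) (∏-pos (u ∘ suc) (h ∘ suc))

∏-zero : ∀ {n} (u : Fin n → ℚ) (k : Fin n) → u k ≡ 0ℚ → ∏ u ≡ 0ℚ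
∏-zero u zero    u0≡0 = trans (cong (_* ∏ (u ∘ suc)) u0≡0) (ℚP.*-zeroˡ (∏ (u ∘ suc)))
∏-zero u (suc k) uk≡0 = trans (cong (u zero *_) (∏-zero (u ∘ suc) k uk≡0)) (ℚP.*-zeroʳ (u zero))

-- Factorisation of sums over points

sumBuckets : (Bucket → ℚ) → ℚ
sumBuckets f = sumℚ (List.map f allBuckets)

sumPoints : (n : ℕ) → (Point n → ℚ) → ℚ
sumPoints n f = sumℚ (List.map f (allPoints n))

fourierSum : ∀ {n} → (Point n → ℚ) → Subset2 n → ℚ
fourierSum {n} f S = sumPoints n (λ x → f x * chi S x)

sumPoints-suc : ∀ n (f : Point (suc n) → ℚ) →
                sumPoints (suc n) f ≡ sumBuckets (λ b → sumPoints n (f ∘ (b ∷_)))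
sumPoints-suc n f = trans (sumℚ-concatMap (λ b → List.map (b ∷_) (allPoints n)) f allBuckets)
                          (sumℚ-cong allBuckets λ b → cong sumℚ (sym (map-∘ {g = f} {f = b ∷_} (allPoints n))))

prodPoint : ∀ {n} → (Fin n → Bucket → ℚ) → Point n → ℚ
prodPoint φ []      = 1ℚ
prodPoint φ (y ∷ x) = φ zero y * prodPoint (φ ∘ suc) x

prodPoint-cong : ∀ {n} {φ ψ : Fin n → Bucket → ℚ} → (∀ k y → φ k y ≡ ψ k y) →
                 ∀ x → prodPoint φ x ≡ prodPoint ψ x
prodPoint-cong eq []      = refl
prodPoint-cong eq (y ∷ x) = cong₂ _*_ (eq zero y) (prodPoint-cong (eq ∘ suc) x)

sumPoints-prodPoint : ∀ n (φ : Fin n → Bucket → ℚ) → sumPoints n (prodPoint φ) ≡ ∏ (sumBuckets ∘ φ)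
sumPoints-prodPoint zero    φ = ℚP.+-identityʳ 1ℚ
sumPoints-prodPoint (suc n) φ = begin
  sumPoints (suc n) (prodPoint φ)
    ≡⟨ sumPoints-suc n (prodPoint φ) ⟩
  sumBuckets (λ b → sumPoints n (λ x → φ zero b * prodPoint (φ ∘ suc) x))
    ≡⟨ sumℚ-cong allBuckets (λ b → sumℚ-*ˡ (φ zero b) (prodPoint (φ ∘ suc)) (allPoints n)) ⟩
  sumBuckets (λ b → φ zero b * sumPoints n (prodPoint (φ ∘ suc)))
    ≡⟨ sumℚ-*ʳ _ (φ zero) allBuckets ⟩
  sumBuckets (φ zero) * sumPoints n (prodPoint (φ ∘ suc))
    ≡⟨ cong (sumBuckets (φ zero) *_) (sumPoints-prodPoint n (φ ∘ suc)) ⟩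
  ∏ (sumBuckets ∘ φ) ∎
  where open ≡-Reasoning

chi₁ : Bool × Bool → Bucket → ℚ
chi₁ (s₁ , s₂) (y₁ , y₂) = (if s₁ then signVal y₁ else 1ℚ) * (if s₂ then signVal y₂ else 1ℚ)

chi-prodPoint : ∀ {n} (S : Subset2 n) (x : Point n) → chi S x ≡ prodPoint (chi₁ ∘ lookup S) x
chi-prodPoint []      []      = refl
chi-prodPoint (s ∷ S) (y ∷ x) = cong (chi₁ s y *_) (chi-prodPoint S x)

δ : Bucket → Bucket → ℚ
δ (p , q) (r , s) = if sameSign p r ∧ sameSign q s then 1ℚ else 0ℚ

sumBuckets-δˡ : (h : Bucket → ℚ) (y : Bucket) → sumBuckets (λ b → δ b y * h b) ≡ h y
sumBuckets-δˡ h (pos , pos) =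
  solve 4 (λ a b c d → con 1ℚ :* a :+ (con 0ℚ :* b :+ (con 0ℚ :* c :+ (con 0ℚ :* d :+ con 0ℚ))) := a)
          refl (h (pos , pos)) (h (pos , neg)) (h (neg , pos)) (h (neg , neg))
sumBuckets-δˡ h (pos , neg) =
  solve 4 (λ a b c d → con 0ℚ :* a :+ (con 1ℚ :* b :+ (con 0ℚ :* c :+ (con 0ℚ :* d :+ con 0ℚ))) := b)
          refl (h (pos , pos)) (h (pos , neg)) (h (neg , pos)) (h (neg , neg))
sumBuckets-δˡ h (neg , pos) =
  solve 4 (λ a b c d → con 0ℚ :* a :+ (con 0ℚ :* b :+ (con 1ℚ :* c :+ (con 0ℚ :* d :+ con 0ℚ))) := c)
          refl (h (pos , pos)) (h (pos , neg)) (h (neg , pos)) (h (neg , neg))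
sumBuckets-δˡ h (neg , neg) =
  solve 4 (λ a b c d → con 0ℚ :* a :+ (con 0ℚ :* b :+ (con 0ℚ :* c :+ (con 1ℚ :* d :+ con 0ℚ))) := d)
          refl (h (pos , pos)) (h (pos , neg)) (h (neg , pos)) (h (neg , neg))

sameSign-sym : ∀ p r → sameSign p r ≡ sameSign r p
sameSign-sym pos pos = refl
sameSign-sym pos neg = refl
sameSign-sym neg pos = refl
sameSign-sym neg neg = refl

δ-sym : ∀ b y → δ b y ≡ δ y b
δ-sym (p , q) (r , s) rewrite sameSign-sym p r | sameSign-sym q s = refl

sumBuckets-δʳ : (h : Bucket → ℚ) (b : Bucket) → sumBuckets (λ y → δ b y * h y) ≡ h b
sumBuckets-δʳ h b = trans (sumℚ-cong allBuckets (λ y → cong (_* h y) (δ-sym b y))) (sumBuckets-δˡ h b)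

∏-pick : ∀ {n} (v : Fin n) (c : ℚ) (w : Fin n → ℚ) → w v ≡ 1ℚ →
         ∏ (λ k → if does (k ≟ v) then c else w k) ≡ c * ∏ w
∏-pick zero    c w wv≡1 = cong (c *_) (sym (trans (cong (_* ∏ (w ∘ suc)) wv≡1) (ℚP.*-identityˡ _)))
∏-pick (suc v) c w wv≡1 = trans (cong (w zero *_) (∏-pick v c (w ∘ suc) wv≡1))
  (solve 3 (λ a b d → a :* (b :* d) := b :* (a :* d)) refl (w zero) c (∏ (w ∘ suc)))

reweight : ∀ {n} → Fin n → (Bucket → ℚ) → (Fin n → Bucket → ℚ) → Fin n → Bucket → ℚ
reweight v h φ k y = if does (k ≟ v) then h y * φ k y else φ k y

reweight-≢ : ∀ {n} {v k : Fin n} (h : Bucket → ℚ) (φ : Fin n → Bucket → ℚ) → k ≢ v →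
             ∀ y → reweight v h φ k y ≡ φ k y
reweight-≢ {v = v} {k} h φ k≢v y = cong (λ d → if d then h y * φ k y else φ k y) (dec-false (k ≟ v) k≢v)

prodPoint-reweight : ∀ {n} (v : Fin n) h φ (x : Point n) →
                     prodPoint (reweight v h φ) x ≡ h (lookup x v) * prodPoint φ x
prodPoint-reweight zero    h φ (y ∷ x) = ℚP.*-assoc (h y) (φ zero y) (prodPoint (φ ∘ suc) x)
prodPoint-reweight (suc v) h φ (y ∷ x) = trans (cong (φ zero y *_) (prodPoint-reweight v h (φ ∘ suc) x))
  (solve 3 (λ a b d → a :* (b :* d) := b :* (a :* d)) refl
          (φ zero y) (h (lookup x v)) (prodPoint (φ ∘ suc) x))

sumBuckets-sift : ∀ {n} (v : Fin n) (F : Bucket → ℚ) (φ : Fin n → Bucket → ℚ) (x : Point n) →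
                  F (lookup x v) * prodPoint φ x ≡ sumBuckets (λ b → F b * prodPoint (reweight v (δ b) φ) x)
sumBuckets-sift v F φ x = begin
  F (lookup x v) * prodPoint φ x
    ≡⟨ cong (_* prodPoint φ x) (sym (sumBuckets-δˡ F (lookup x v))) ⟩
  sumBuckets (λ b → δ b (lookup x v) * F b) * prodPoint φ x
    ≡⟨ sym (sumℚ-*ʳ (prodPoint φ x) (λ b → δ b (lookup x v) * F b) allBuckets) ⟩
  sumBuckets (λ b → δ b (lookup x v) * F b * prodPoint φ x)
    ≡⟨ sumℚ-cong allBuckets (λ b → solve 3 (λ d a p → d :* a :* p := a :* (d :* p)) refl
                                      (δ b (lookup x v)) (F b) (prodPoint φ x)) ⟩
  sumBuckets (λ b → F b * (δ b (lookup x v) * prodPoint φ x))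
    ≡⟨ sumℚ-cong allBuckets (λ b → cong (F b *_) (sym (prodPoint-reweight v (δ b) φ x))) ⟩
  sumBuckets (λ b → F b * prodPoint (reweight v (δ b) φ) x) ∎
  where open ≡-Reasoning

_∈?_ : ∀ {n r} (k : Fin n) (vs : Vec (Fin n) r) → Dec (k ∈ vs)
k ∈? vs = any? (k ≟_) vs

outside : ∀ {n r} → (Fin n → Bucket → ℚ) → Vec (Fin n) r → ℚ
outside φ vs = ∏ λ k → if does (k ∈? vs) then 1ℚ else sumBuckets (φ k)

outside-reweight : ∀ {n r} (v : Fin n) (vs : Vec (Fin n) r) → v ∉ vs → ∀ φ b →
                   outside (reweight v (δ b) φ) vs ≡ φ v b * outside φ (v ∷ vs)
outside-reweight {n} v vs v∉vs φ b =
  trans (∏-cong factor)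
        (∏-pick v (φ v b) w (cong (λ d → if d then 1ℚ else sumBuckets (φ v))
                                  (dec-true (v ∈? (v ∷ vs)) (here refl))))
  where
  w : Fin n → ℚ
  w k = if does (k ∈? (v ∷ vs)) then 1ℚ else sumBuckets (φ k)
  factor : ∀ k → (if does (k ∈? vs) then 1ℚ else sumBuckets (reweight v (δ b) φ k))
                 ≡ (if does (k ≟ v) then φ v b else w k)
  factor k with k ≟ v
  ... | yes refl =
    trans (cong (λ d → if d then 1ℚ else sumBuckets (λ y → δ b y * φ k y)) (dec-false (k ∈? vs) v∉vs))
          (sumBuckets-δʳ (φ k) b)
  ... | no _ = refl

sumPoints-suc-prodPoint : ∀ r (f : Point (suc r) → ℚ) (ψ : Fin (suc r) → Bucket → ℚ) (c : ℚ) →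
  sumBuckets (λ b → sumPoints r (λ y → f (b ∷ y) * prodPoint (ψ ∘ suc) y) * (ψ zero b * c))
    ≡ sumPoints (suc r) (λ y → f y * prodPoint ψ y) * c
sumPoints-suc-prodPoint r f ψ c = begin
  sumBuckets (λ b → F b * (ψ zero b * c))
    ≡⟨ sumℚ-cong allBuckets (λ b →
         solve 3 (λ s a d → s :* (a :* d) := a :* s :* d) refl (F b) (ψ zero b) c) ⟩
  sumBuckets (λ b → ψ zero b * F b * c)
    ≡⟨ sumℚ-*ʳ c (λ b → ψ zero b * F b) allBuckets ⟩
  sumBuckets (λ b → ψ zero b * F b) * c
    ≡⟨ cong (_* c) (sumℚ-cong allBuckets λ b →
         sym (sumℚ-*ˡ (ψ zero b) (λ y → f (b ∷ y) * P y) (allPoints r))) ⟩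
  sumBuckets (λ b → sumPoints r (λ y → ψ zero b * (f (b ∷ y) * P y))) * c
    ≡⟨ cong (_* c) (sumℚ-cong allBuckets λ b → sumℚ-cong (allPoints r) λ y →
         solve 3 (λ a e p → a :* (e :* p) := e :* (a :* p)) refl (ψ zero b) (f (b ∷ y)) (P y)) ⟩
  sumBuckets (λ b → sumPoints r (λ y → f (b ∷ y) * prodPoint ψ (b ∷ y))) * c
    ≡⟨ cong (_* c) (sym (sumPoints-suc r (λ y → f y * prodPoint ψ y))) ⟩
  sumPoints (suc r) (λ y → f y * prodPoint ψ y) * c ∎
  where
  open ≡-Reasoning
  P : Point r → ℚ
  P = prodPoint (ψ ∘ suc)
  F : Bucket → ℚ
  F b = sumPoints r (λ y → f (b ∷ y) * P y)

-- Sifting each coordinate v of vs through δ moves the dependence of f on x_v into the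
-- v-th factor of the product, after which the coordinates outside vs are summed independently.
sumPoints-local : ∀ {n r} (vs : Vec (Fin n) r) → Unique vs →
                  (f : Point r → ℚ) (φ : Fin n → Bucket → ℚ) →
  sumPoints n (λ x → f (Vec.map (lookup x) vs) * prodPoint φ x)
    ≡ sumPoints r (λ y → f y * prodPoint (φ ∘ lookup vs) y) * outside φ vs
sumPoints-local {n} [] [] f φ = begin
  sumPoints n (λ x → f [] * prodPoint φ x)
    ≡⟨ sumℚ-*ˡ (f []) (prodPoint φ) (allPoints n) ⟩
  f [] * sumPoints n (prodPoint φ)
    ≡⟨ cong (f [] *_) (sumPoints-prodPoint n φ) ⟩
  f [] * ∏ (sumBuckets ∘ φ)
    ≡⟨ cong (_* ∏ (sumBuckets ∘ φ)) (solve 1 (λ a → a := a :* con 1ℚ :+ con 0ℚ) refl (f [])) ⟩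
  (f [] * 1ℚ + 0ℚ) * outside φ [] ∎
  where open ≡-Reasoning
sumPoints-local {n} {suc r} (v ∷ vs) (v≢vs ∷ unique) f φ = begin
  sumPoints n (λ x → f (lookup x v ∷ rest x) * prodPoint φ x)
    ≡⟨ sumℚ-cong (allPoints n) (λ x → sumBuckets-sift v (λ b → f (b ∷ rest x)) φ x) ⟩
  sumPoints n (λ x → sumBuckets (λ b → f (b ∷ rest x) * prodPoint (φ′ b) x))
    ≡⟨ sumℚ-swap (λ x b → f (b ∷ rest x) * prodPoint (φ′ b) x) (allPoints n) allBuckets ⟩
  sumBuckets (λ b → sumPoints n (λ x → f (b ∷ rest x) * prodPoint (φ′ b) x))
    ≡⟨ sumℚ-cong allBuckets (λ b → sumPoints-local vs unique (f ∘ (b ∷_)) (φ′ b)) ⟩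
  sumBuckets (λ b → sumPoints r (λ y → f (b ∷ y) * prodPoint (φ′ b ∘ lookup vs) y) * outside (φ′ b) vs)
    ≡⟨ sumℚ-cong allBuckets (λ b → cong₂ _*_
         (sumℚ-cong (allPoints r) λ y → cong (f (b ∷ y) *_) (prodPoint-cong (agree b) y))
         (outside-reweight v vs v∉vs φ b)) ⟩
  sumBuckets (λ b → sumPoints r (λ y → f (b ∷ y) * prodPoint (φ ∘ lookup vs) y)
                    * (φ v b * outside φ (v ∷ vs)))
    ≡⟨ sumPoints-suc-prodPoint r f (φ ∘ lookup (v ∷ vs)) (outside φ (v ∷ vs)) ⟩
  sumPoints (suc r) (λ y → f y * prodPoint (φ ∘ lookup (v ∷ vs)) y) * outside φ (v ∷ vs) ∎
  where
  open ≡-Reasoning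
  rest : Point n → Point r
  rest x = Vec.map (lookup x) vs
  φ′ : Bucket → Fin n → Bucket → ℚ
  φ′ b = reweight v (δ b) φ
  v∉vs : v ∉ vs
  v∉vs v∈vs = All.lookup v≢vs v∈vs refl
  agree : ∀ b j y → φ′ b (lookup vs j) y ≡ φ (lookup vs j) y
  agree b j = reweight-≢ (δ b) φ (λ eq → All.lookup v≢vs (∈-lookup j vs) (sym eq))

NonEmpty : Bool × Bool → Set
NonEmpty s = (proj₁ s ∨ proj₂ s) ≡ true

FF FT TF TT : Bool × Bool
FF = false , false
FT = false , true
TF = true  , false
TT = true  , true

sumBuckets-chi₁-nonempty : ∀ s → NonEmpty s → sumBuckets (chi₁ s) ≡ 0ℚ
sumBuckets-chi₁-nonempty (false , true)  _ = refl
sumBuckets-chi₁-nonempty (true  , false) _ = refl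
sumBuckets-chi₁-nonempty (true  , true)  _ = refl

sumBuckets-chi₁-empty : 0ℚ < sumBuckets (chi₁ FF)
sumBuckets-chi₁-empty = toWitness {a? = 0ℚ ℚP.<? sumBuckets (chi₁ FF)} _

sumBuckets-chi₁-nonneg : ∀ s → 0ℚ ≤ sumBuckets (chi₁ s)
sumBuckets-chi₁-nonneg (false , false) = ℚP.<⇒≤ sumBuckets-chi₁-empty
sumBuckets-chi₁-nonneg (false , true)  = ℚP.≤-refl
sumBuckets-chi₁-nonneg (true  , false) = ℚP.≤-refl
sumBuckets-chi₁-nonneg (true  , true)  = ℚP.≤-refl

module _ {n r} (S : Subset2 n) (vs : Vec (Fin n) r) where

  outside-nonneg : 0ℚ ≤ outside (chi₁ ∘ lookup S) vs
  outside-nonneg = ∏-nonneg _ λ k → factor (does (k ∈? vs)) (lookup S k)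
    where
    factor : ∀ d s → 0ℚ ≤ (if d then 1ℚ else sumBuckets (chi₁ s))
    factor true  s = ℚP.<⇒≤ 0<1
    factor false s = sumBuckets-chi₁-nonneg s

  outside-≡0 : ∀ {k} → k ∉ vs → NonEmpty (lookup S k) → outside (chi₁ ∘ lookup S) vs ≡ 0ℚ
  outside-≡0 {k} k∉vs nonempty = ∏-zero _ k (trans
    (cong (λ d → if d then 1ℚ else sumBuckets (chi₁ (lookup S k))) (dec-false (k ∈? vs) k∉vs))
    (sumBuckets-chi₁-nonempty (lookup S k) nonempty))

  outside-pos : (∀ k → k ∉ vs → lookup S k ≡ FF) → 0ℚ < outside (chi₁ ∘ lookup S) vs
  outside-pos empty = ∏-pos _ factor
    where
    factor : ∀ k → 0ℚ < (if does (k ∈? vs) then 1ℚ else sumBuckets (chi₁ (lookup S k)))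
    factor k with k ∈? vs
    ... | yes _   = 0<1
    ... | no k∉vs = subst (λ s → 0ℚ < sumBuckets (chi₁ s)) (sym (empty k k∉vs)) sumBuckets-chi₁-empty

-- Contributions of single constraints

arity : ∀ {n} → Tuple n → ℕ
arity (bin _ _)    = 2
arity (tern _ _ _) = 3

vars : ∀ {n} (t : Tuple n) → Vec (Fin n) (arity t)
vars (bin a b)    = a ∷ b ∷ []
vars (tern a b c) = a ∷ b ∷ c ∷ []

Distinct⇒Unique : ∀ {n} {t : Tuple n} → Distinct t → Unique (vars t)
Distinct⇒Unique {t = bin a b}    a≢b              = (a≢b ∷ []) ∷ [] ∷ []
Distinct⇒Unique {t = tern a b c} (a≢b , a≢c , b≢c) = (a≢b ∷ a≢c ∷ []) ∷ (b≢c ∷ []) ∷ [] ∷ []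

Occurs⇒∈vars : ∀ {n} {v : Fin n} t → Occurs v t → v ∈ vars t
Occurs⇒∈vars (bin a b)    (inj₁ v≡a)        = here v≡a
Occurs⇒∈vars (bin a b)    (inj₂ v≡b)        = there (here v≡b)
Occurs⇒∈vars (tern a b c) (inj₁ v≡a)        = here v≡a
Occurs⇒∈vars (tern a b c) (inj₂ (inj₁ v≡b)) = there (here v≡b)
Occurs⇒∈vars (tern a b c) (inj₂ (inj₂ v≡c)) = there (there (here v≡c))

prob2ᵛ : Point 2 → ℚ
prob2ᵛ (y₁ ∷ y₂ ∷ []) = prob2 y₁ y₂

prob3ᵛ : Point 3 → ℚ
prob3ᵛ (y₁ ∷ y₂ ∷ y₃ ∷ []) = prob3 y₁ y₂ y₃

localProb : ∀ {n} (t : Tuple n) → Point (arity t) → ℚ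
localProb (bin _ _)    = prob2ᵛ
localProb (tern _ _ _) = prob3ᵛ

gE-local : ∀ {n} (x : Point n) t → gE x t ≡ localProb t (Vec.map (lookup x) (vars t))
gE-local x (bin _ _)    = refl
gE-local x (tern _ _ _) = refl

contribution : ∀ {n} → Subset2 n → Tuple n → ℚ
contribution S t = fourierSum (λ x → gE x t) S

restrict : ∀ {n r} → Subset2 n → Vec (Fin n) r → Subset2 r
restrict S vs = Vec.map (lookup S) vs

contribution-factor : ∀ {n} (S : Subset2 n) t → Distinct t →
  contribution S t ≡ fourierSum (localProb t) (restrict S (vars t)) * outside (chi₁ ∘ lookup S) (vars t)
contribution-factor {n} S t distinct = begin
  sumPoints n (λ x → gE x t * chi S x)
    ≡⟨ sumℚ-cong (allPoints n) (λ x → cong₂ _*_ (gE-local x t) (chi-prodPoint S x)) ⟩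
  sumPoints n (λ x → localProb t (Vec.map (lookup x) (vars t)) * prodPoint (chi₁ ∘ lookup S) x)
    ≡⟨ sumPoints-local (vars t) (Distinct⇒Unique distinct) (localProb t) (chi₁ ∘ lookup S) ⟩
  sumPoints (arity t) (λ y → localProb t y * prodPoint (chi₁ ∘ lookup S ∘ lookup (vars t)) y) * O
    ≡⟨ cong (_* O) (sumℚ-cong (allPoints (arity t)) λ y → cong (localProb t y *_) (sym (chi-restrict y))) ⟩
  fourierSum (localProb t) (restrict S (vars t)) * O ∎
  where
  open ≡-Reasoning
  O : ℚ
  O = outside (chi₁ ∘ lookup S) (vars t)
  chi-restrict : ∀ y → chi (restrict S (vars t)) y ≡ prodPoint (chi₁ ∘ lookup S ∘ lookup (vars t)) y
  chi-restrict y = trans (chi-prodPoint (restrict S (vars t)) y)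
    (prodPoint-cong (λ j z → cong (λ s → chi₁ s z) (lookup-map j (lookup S) (vars t))) y)

module _ {n} (S : Subset2 n) (t : Tuple n) (distinct : Distinct t) where

  contribution-≡0 : ∀ {k} → k ∉ vars t → NonEmpty (lookup S k) → contribution S t ≡ 0ℚ
  contribution-≡0 k∉t nonempty = trans (contribution-factor S t distinct)
    (trans (cong (fourierSum (localProb t) (restrict S (vars t)) *_) (outside-≡0 S (vars t) k∉t nonempty))
           (ℚP.*-zeroʳ (fourierSum (localProb t) (restrict S (vars t)))))

  contribution-nonneg : 0ℚ ≤ fourierSum (localProb t) (restrict S (vars t)) → 0ℚ ≤ contribution S t
  contribution-nonneg local-nonneg = subst (0ℚ ≤_) (sym (contribution-factor S t distinct))
    (*-nonneg local-nonneg (outside-nonneg S (vars t)))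

  contribution-pos : (∀ k → k ∉ vars t → lookup S k ≡ FF) →
                     0ℚ < fourierSum (localProb t) (restrict S (vars t)) → 0ℚ < contribution S t
  contribution-pos empty local-pos = subst (0ℚ <_) (sym (contribution-factor S t distinct))
    (*-pos local-pos (outside-pos S (vars t) empty))

weightℚ : ∀ {n} → Constraint n → ℚ
weightℚ e = (ℤ+ weight e) / 1

weightℚ-nonneg : ∀ {n} (e : Constraint n) → 0ℚ ≤ weightℚ e
weightℚ-nonneg e = ℚP.nonNegative⁻¹ _ {{ℚP.normalize-nonNeg (weight e) 1}}

weightℚ-pos : ∀ {n} (e : Constraint n) → weight e ≢ 0 → 0ℚ < weightℚ e
weightℚ-pos e w≢0 with weight e
... | zero  = ⊥-elim (w≢0 refl)
... | suc w = ℚP.positive⁻¹ _ {{ℚP.normalize-pos (suc w) 1}}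

fourierSum-g : (I : Instance) (S : Subset2 (n I)) →
  fourierSum (g I) S ≡ sumℚ (List.map (λ e → weightℚ e * contribution S (tuple e)) (cons I))
fourierSum-g I S = begin
  sumPoints (n I) (λ x → g I x * chi S x)
    ≡⟨ sumℚ-cong (allPoints (n I)) distribute ⟩
  sumPoints (n I) (λ x → sumℚ (List.map (F x) (cons I)))
    ≡⟨ sumℚ-swap F (allPoints (n I)) (cons I) ⟩
  sumℚ (List.map (λ e → sumPoints (n I) (λ x → F x e)) (cons I))
    ≡⟨ sumℚ-cong (cons I) (λ e → sumℚ-*ˡ (weightℚ e) (λ x → gE x (tuple e) * chi S x) (allPoints (n I))) ⟩
  sumℚ (List.map (λ e → weightℚ e * contribution S (tuple e)) (cons I)) ∎
  where
  open ≡-Reasoning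
  F : Point (n I) → Constraint (n I) → ℚ
  F x e = weightℚ e * (gE x (tuple e) * chi S x)
  distribute : ∀ x → g I x * chi S x ≡ sumℚ (List.map (F x) (cons I))
  distribute x = trans (sym (sumℚ-*ʳ (chi S x) (λ e → weightℚ e * gE x (tuple e)) (cons I)))
    (sumℚ-cong (cons I) (λ e → ℚP.*-assoc (weightℚ e) (gE x (tuple e)) (chi S x)))

tuple-distinct : (I : Instance) → ∀ {t} → t ∈ₗ tuples I → Distinct t
tuple-distinct I t∈I with ∈ₗ-map⁻ tuple t∈I
... | e , e∈I , refl = AllL.lookup (distinct I) e∈I

ghat≢0 : (I : Instance) → Irreducible I → (S : Subset2 (n I)) →
         (∀ {t} → t ∈ₗ tuples I → 0ℚ ≤ contribution S t) →
         ∀ {t₀} → t₀ ∈ₗ tuples I → 0ℚ < contribution S t₀ → ghat I S ≢ 0ℚ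
ghat≢0 I irr S nonneg t₀∈I pos₀ ghat≡0 with ∈ₗ-map⁻ tuple t₀∈I
... | e₀ , e₀∈I , refl = ℚP.<⇒≢ ghat-pos (sym ghat≡0)
  where
  sum-pos : 0ℚ < fourierSum (g I) S
  sum-pos = subst (0ℚ <_) (sym (fourierSum-g I S))
    (sumℚ-pos _ (cons I) (λ e e∈I → *-nonneg (weightℚ-nonneg e) (nonneg (∈ₗ-map⁺ tuple e∈I))) e₀∈I
              (*-pos (weightℚ-pos e₀ (AllL.lookup (Irreducible.weightsNonzero irr) e₀∈I)) pos₀))
  ghat-pos : 0ℚ < ghat I S
  ghat-pos = *-pos sum-pos (ℚP.positive⁻¹ _ {{ℚP.normalize-pos 1 (4 ^ n I) {{m^n≢0 4 (n I)}}}})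

-- Subsets supported on the variables of a constraint

place : ∀ {n r} → Vec (Fin n) r → Subset2 r → Subset2 n
place {n} []       []       = Vec.replicate n FF
place     (v ∷ vs) (p ∷ ps) = place vs ps [ v ]≔ p

module Placement {n r} (vs : Vec (Fin n) r) (ps : Subset2 r)
                 (vs-unique : Unique vs) (ps-unique : Unique ps) (ps-nonempty : All NonEmpty ps) where

  S : Subset2 n
  S = place vs ps

  nonempty : ∀ j → NonEmpty (lookup ps j)
  nonempty j = All.lookup ps-nonempty (∈-lookup j ps)

  lookup-place : ∀ j → lookup S (lookup vs j) ≡ lookup ps j
  lookup-place = go vs ps vs-unique
    where
    go : ∀ {r} (vs : Vec (Fin n) r) ps → Unique vs → ∀ j → lookup (place vs ps) (lookup vs j) ≡ lookup ps j
    go (v ∷ vs) (p ∷ ps) _               zero    = lookup∘update v (place vs ps) p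
    go (v ∷ vs) (p ∷ ps) (v≢vs ∷ unique) (suc j) =
      trans (lookup∘update′ (λ eq → All.lookup v≢vs (∈-lookup j vs) (sym eq)) (place vs ps) p)
            (go vs ps unique j)

  lookup-place-∉ : ∀ {u} → u ∉ vs → lookup S u ≡ FF
  lookup-place-∉ = go vs ps
    where
    go : ∀ {r u} (vs : Vec (Fin n) r) ps → u ∉ vs → lookup (place vs ps) u ≡ FF
    go {u = u} []       []       _    = lookup-replicate u FF
    go         (v ∷ vs) (p ∷ ps) u∉vs =
      trans (lookup∘update′ (u∉vs ∘ here) (place vs ps) p) (go vs ps (u∉vs ∘ there))

  place-injective : ∀ {u} j → lookup S u ≡ lookup ps j → u ≡ lookup vs j
  place-injective {u} j Su≡psj with u ∈? vs
  ... | yes u∈vs = trans (lookup-index u∈vs) (cong (lookup vs) (lookup-injective ps-unique _ j psi≡psj))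
    where
    psi≡psj : lookup ps (index u∈vs) ≡ lookup ps j
    psi≡psj = trans (sym (lookup-place (index u∈vs)))
                    (trans (cong (lookup S) (sym (lookup-index u∈vs))) Su≡psj)
  ... | no u∉vs with () ← subst NonEmpty (trans (sym Su≡psj) (lookup-place-∉ u∉vs)) (nonempty j)

  place-nonempty : ∀ {u} → u ∈ vs → NonEmpty (lookup S u)
  place-nonempty u∈vs = subst (NonEmpty ∘ lookup S) (sym (lookup-index u∈vs))
    (subst NonEmpty (sym (lookup-place (index u∈vs))) (nonempty (index u∈vs)))

  restrict-place : restrict S vs ≡ ps
  restrict-place = trans (sym (tabulate∘lookup (restrict S vs)))
    (trans (tabulate-cong λ j → trans (lookup-map j (lookup S) vs) (lookup-place j)) (tabulate∘lookup ps))

  restrict-injective₂ : ∀ {a b} i j → restrict S (a ∷ b ∷ []) ≡ lookup ps i ∷ lookup ps j ∷ [] →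
                        bin a b ≡ bin (lookup vs i) (lookup vs j)
  restrict-injective₂ i j eq =
    cong₂ bin (place-injective i (∷-injectiveˡ eq)) (place-injective j (∷-injectiveˡ (∷-injectiveʳ eq)))

  restrict-injective₃ : ∀ {a b c} i j k →
                        restrict S (a ∷ b ∷ c ∷ []) ≡ lookup ps i ∷ lookup ps j ∷ lookup ps k ∷ [] →
                        tern a b c ≡ tern (lookup vs i) (lookup vs j) (lookup vs k)
  restrict-injective₃ i j k eq =
    tern-cong (place-injective i (∷-injectiveˡ eq)) (place-injective j (∷-injectiveˡ (∷-injectiveʳ eq)))
              (place-injective k (∷-injectiveˡ (∷-injectiveʳ (∷-injectiveʳ eq))))
    where
    tern-cong : ∀ {a b c a′ b′ c′} → a ≡ a′ → b ≡ b′ → c ≡ c′ → tern a b c ≡ tern a′ b′ c′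
    tern-cong refl refl refl = refl

  contribution-≡0-absent : ∀ t → Distinct t → ∀ j → lookup ps j ∉ restrict S (vars t) →
                           contribution S t ≡ 0ℚ
  contribution-≡0-absent t distinct j absent = contribution-≡0 S t distinct
    (λ vj∈t → absent (subst (_∈ restrict S (vars t)) (lookup-place j) (∈-map⁺ (lookup S) vj∈t)))
    (subst NonEmpty (sym (lookup-place j)) (nonempty j))

  contribution-nonneg-absent : ∀ t → Distinct t → ∀ j → lookup ps j ∉ restrict S (vars t) →
                               0ℚ ≤ contribution S t
  contribution-nonneg-absent t distinct j absent =
    ℚP.≤-reflexive (sym (contribution-≡0-absent t distinct j absent))

-- Local Fourier sums of prob2 and prob3, by evaluation

_≟ₛ_ : DecidableEquality (Bool × Bool)
_≟ₛ_ = ×-≡-dec Bool._≟_ Bool._≟_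

_∈ₛ?_ : ∀ {r} (s : Bool × Bool) (ss : Subset2 r) → Dec (s ∈ ss)
s ∈ₛ? ss = any? (s ≟ₛ_) ss

_≟ᵥ_ : ∀ {r} → DecidableEquality (Subset2 r)
_≟ᵥ_ = Vec-≡-dec _≟ₛ_

∀-pair? : {P : Bool × Bool → Set} → Decidable P → Dec (∀ s → P s)
∀-pair? P? = map′ (λ { (p₁ , _  , _  , _ ) (false , false) → p₁
                     ; (_  , p₂ , _  , _ ) (false , true)  → p₂
                     ; (_  , _  , p₃ , _ ) (true  , false) → p₃
                     ; (_  , _  , _  , p₄) (true  , true)  → p₄ })
                  (λ h → h FF , h FT , h TF , h TT)
                  (P? FF ×-dec P? FT ×-dec P? TF ×-dec P? TT)

∀-subset? : ∀ r {P : Subset2 r → Set} → Decidable P → Dec (∀ s → P s)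
∀-subset? zero    P? = map′ (λ { p [] → p }) (λ h → h []) (P? [])
∀-subset? (suc r) P? = map′ (λ { h (s ∷ ss) → h s ss }) (λ h s ss → h (s ∷ ss))
                            (∀-pair? λ s → ∀-subset? r λ ss → P? (s ∷ ss))

-- The two excluded patterns are FT TT TF in the orders 1 3 2 and 2 3 1.
ternary-patterns : ∀ (s : Subset2 3) →
  FT ∉ s ⊎ TT ∉ s ⊎ TF ∉ s ⊎ 0ℚ ≤ fourierSum prob3ᵛ s ⊎ s ≡ FT ∷ TF ∷ TT ∷ [] ⊎ s ≡ TT ∷ TF ∷ FT ∷ []
ternary-patterns = toWitness {a? = ∀-subset? 3 λ s →
  ¬? (FT ∈ₛ? s) ⊎-dec ¬? (TT ∈ₛ? s) ⊎-dec ¬? (TF ∈ₛ? s) ⊎-dec 0ℚ ℚP.≤? fourierSum prob3ᵛ s ⊎-dec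
  s ≟ᵥ (FT ∷ TF ∷ TT ∷ []) ⊎-dec s ≟ᵥ (TT ∷ TF ∷ FT ∷ [])} _

binary-patterns : ∀ (s : Subset2 2) → TT ∉ s ⊎ TF ∉ s ⊎ 0ℚ ≤ fourierSum prob2ᵛ s ⊎ s ≡ TF ∷ TT ∷ []
binary-patterns = toWitness {a? = ∀-subset? 2 λ s →
  ¬? (TT ∈ₛ? s) ⊎-dec ¬? (TF ∈ₛ? s) ⊎-dec 0ℚ ℚP.≤? fourierSum prob2ᵛ s ⊎-dec s ≟ᵥ (TF ∷ TT ∷ [])} _


pair-misses-one-of-three : ∀ (s : Subset2 2) → FT ∉ s ⊎ TT ∉ s ⊎ TF ∉ s
pair-misses-one-of-three =
  toWitness {a? = ∀-subset? 2 λ s → ¬? (FT ∈ₛ? s) ⊎-dec ¬? (TT ∈ₛ? s) ⊎-dec ¬? (TF ∈ₛ? s)} _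

fourierSum-prob3-FT-TT-TF : 0ℚ < fourierSum prob3ᵛ (FT ∷ TT ∷ TF ∷ [])
fourierSum-prob3-FT-TT-TF = toWitness {a? = 0ℚ ℚP.<? fourierSum prob3ᵛ (FT ∷ TT ∷ TF ∷ [])} _

fourierSum-prob3-TF-FT-TT : 0ℚ < fourierSum prob3ᵛ (TF ∷ FT ∷ TT ∷ [])
fourierSum-prob3-TF-FT-TT = toWitness {a? = 0ℚ ℚP.<? fourierSum prob3ᵛ (TF ∷ FT ∷ TT ∷ [])} _

fourierSum-prob2-TT-TF : 0ℚ < fourierSum prob2ᵛ (TT ∷ TF ∷ [])
fourierSum-prob2-TT-TF = toWitness {a? = 0ℚ ℚP.<? fourierSum prob2ᵛ (TT ∷ TF ∷ [])} _

-- Irreducible instances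

InTernary : ∀ {n} → Fin n → Tuple n → Set
InTernary i (bin _ _)    = ⊥
InTernary i (tern a b c) = i ∈ (a ∷ b ∷ c ∷ [])

inTernary? : ∀ {n} (i : Fin n) → Decidable (InTernary i)
inTernary? i (bin _ _)    = no λ ()
inTernary? i (tern a b c) = i ∈? (a ∷ b ∷ c ∷ [])

Representation : (I : Instance) → Fin (n I) → Set
Representation I i = ∃[ S ] (NonEmpty (lookup S i) × ghat I S ≢ 0ℚ)

∈-rotate : ∀ {A : Set} {a b c k : A} → k ∈ (a ∷ b ∷ c ∷ []) → k ∈ (b ∷ c ∷ a ∷ [])
∈-rotate (here k≡a)                 = there (there (here k≡a))
∈-rotate (there (here k≡b))         = here k≡b
∈-rotate (there (there (here k≡c))) = there (here k≡c)

FT-TT-TF-unique : Unique (FT ∷ TT ∷ TF ∷ [])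
FT-TT-TF-unique = ((λ ()) ∷ (λ ()) ∷ []) ∷ ((λ ()) ∷ []) ∷ [] ∷ []

TT-TF-unique : Unique (TT ∷ TF ∷ [])
TT-TF-unique = ((λ ()) ∷ []) ∷ [] ∷ []

module TernaryWitness (I : Instance) (irr : Irreducible I) {x y z : Fin (n I)}
                      (x≢y : x ≢ y) (x≢z : x ≢ z) (y≢z : y ≢ z) where

  open Placement (x ∷ y ∷ z ∷ []) (FT ∷ TT ∷ TF ∷ []) (Distinct⇒Unique {t = tern x y z} (x≢y , x≢z , y≢z))
                 FT-TT-TF-unique (refl ∷ refl ∷ refl ∷ [])

  contribution-xyz-pos : 0ℚ < contribution S (tern x y z)
  contribution-xyz-pos = contribution-pos S (tern x y z) (x≢y , x≢z , y≢z) (λ _ → lookup-place-∉)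
    (subst (λ (s : Subset2 3) → 0ℚ < fourierSum prob3ᵛ s) (sym restrict-place) fourierSum-prob3-FT-TT-TF)

  contribution-zxy-pos : 0ℚ < contribution S (tern z x y)
  contribution-zxy-pos = contribution-pos S (tern z x y) (≢-sym x≢z , ≢-sym y≢z , x≢y)
    (λ _ k∉zxy → lookup-place-∉ (k∉zxy ∘ ∈-rotate ∘ ∈-rotate))
    (subst (λ (s : Subset2 3) → 0ℚ < fourierSum prob3ᵛ s) (sym restrict-zxy) fourierSum-prob3-TF-FT-TT)
    where
    restrict-zxy : restrict S (z ∷ x ∷ y ∷ []) ≡ TF ∷ FT ∷ TT ∷ []
    restrict-zxy = cong₂ _∷_ (lookup-place 2F) (cong₂ _∷_ (lookup-place 0F) (cong₂ _∷_ (lookup-place 1F) refl))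

  contribution-nonneg-all : tern x z y ∉ₗ tuples I → tern y z x ∉ₗ tuples I →
                            ∀ {t} → t ∈ₗ tuples I → 0ℚ ≤ contribution S t
  contribution-nonneg-all xzy∉I yzx∉I {t} t∈I = by-pattern t (tuple-distinct I t∈I) t∈I
    where
    by-binary-pattern : ∀ {a b} → Distinct (bin a b) → let s = restrict S (a ∷ b ∷ []) in
      FT ∉ s ⊎ TT ∉ s ⊎ TF ∉ s → 0ℚ ≤ contribution S (bin a b)
    by-binary-pattern d (inj₁ absent)        = contribution-nonneg-absent _ d 0F absent
    by-binary-pattern d (inj₂ (inj₁ absent)) = contribution-nonneg-absent _ d 1F absent
    by-binary-pattern d (inj₂ (inj₂ absent)) = contribution-nonneg-absent _ d 2F absent

    by-ternary-pattern : ∀ {a b c} → Distinct (tern a b c) → tern a b c ∈ₗ tuples I →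
      let s = restrict S (a ∷ b ∷ c ∷ []) in
      FT ∉ s ⊎ TT ∉ s ⊎ TF ∉ s ⊎ 0ℚ ≤ fourierSum prob3ᵛ s ⊎ s ≡ FT ∷ TF ∷ TT ∷ [] ⊎ s ≡ TT ∷ TF ∷ FT ∷ [] →
      0ℚ ≤ contribution S (tern a b c)
    by-ternary-pattern d _ (inj₁ absent)                            = contribution-nonneg-absent _ d 0F absent
    by-ternary-pattern d _ (inj₂ (inj₁ absent))                     = contribution-nonneg-absent _ d 1F absent
    by-ternary-pattern d _ (inj₂ (inj₂ (inj₁ absent)))              = contribution-nonneg-absent _ d 2F absent
    by-ternary-pattern d _ (inj₂ (inj₂ (inj₂ (inj₁ local-nonneg)))) = contribution-nonneg S _ d local-nonneg
    by-ternary-pattern d t∈I (inj₂ (inj₂ (inj₂ (inj₂ (inj₁ xzy))))) =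
      ⊥-elim (xzy∉I (subst (_∈ₗ tuples I) (restrict-injective₃ 0F 2F 1F xzy) t∈I))
    by-ternary-pattern d t∈I (inj₂ (inj₂ (inj₂ (inj₂ (inj₂ yzx))))) =
      ⊥-elim (yzx∉I (subst (_∈ₗ tuples I) (restrict-injective₃ 1F 2F 0F yzx) t∈I))

    by-pattern : ∀ t → Distinct t → t ∈ₗ tuples I → 0ℚ ≤ contribution S t
    by-pattern (bin a b)    d _   =
      by-binary-pattern d (pair-misses-one-of-three (restrict S (a ∷ b ∷ [])))
    by-pattern (tern a b c) d t∈I =
      by-ternary-pattern d t∈I (ternary-patterns (restrict S (a ∷ b ∷ c ∷ [])))

  representation : tern x z y ∉ₗ tuples I → tern y z x ∉ₗ tuples I →
                   ∀ {t₀} → t₀ ∈ₗ tuples I → 0ℚ < contribution S t₀ →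
                   ∀ {i} → i ∈ (x ∷ y ∷ z ∷ []) → Representation I i
  representation xzy∉I yzx∉I t₀∈I pos₀ i∈xyz =
    S , place-nonempty i∈xyz , ghat≢0 I irr S (contribution-nonneg-all xzy∉I yzx∉I) t₀∈I pos₀

module BinaryWitness (I : Instance) (irr : Irreducible I) {a b : Fin (n I)} (a≢b : a ≢ b) where

  open Placement (a ∷ b ∷ []) (TT ∷ TF ∷ []) (Distinct⇒Unique {t = bin a b} a≢b)
                 TT-TF-unique (refl ∷ refl ∷ [])

  contribution-nonneg-all : bin b a ∉ₗ tuples I → ∀ {i} → i ∈ (a ∷ b ∷ []) →
                            (∀ {t} → t ∈ₗ tuples I → ¬ InTernary i t) →
                            ∀ {t} → t ∈ₗ tuples I → 0ℚ ≤ contribution S t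
  contribution-nonneg-all ba∉I i∈ab not-ternary {t} t∈I = by-pattern t (tuple-distinct I t∈I) t∈I
    where
    by-binary-pattern : ∀ {a′ b′} → Distinct (bin a′ b′) → bin a′ b′ ∈ₗ tuples I →
      let s = restrict S (a′ ∷ b′ ∷ []) in
      TT ∉ s ⊎ TF ∉ s ⊎ 0ℚ ≤ fourierSum prob2ᵛ s ⊎ s ≡ TF ∷ TT ∷ [] → 0ℚ ≤ contribution S (bin a′ b′)
    by-binary-pattern d _   (inj₁ absent)                     = contribution-nonneg-absent _ d 0F absent
    by-binary-pattern d _   (inj₂ (inj₁ absent))              = contribution-nonneg-absent _ d 1F absent
    by-binary-pattern d _   (inj₂ (inj₂ (inj₁ local-nonneg))) = contribution-nonneg S _ d local-nonneg
    by-binary-pattern d t∈I (inj₂ (inj₂ (inj₂ ba)))           =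
      ⊥-elim (ba∉I (subst (_∈ₗ tuples I) (restrict-injective₂ 1F 0F ba) t∈I))

    by-pattern : ∀ t → Distinct t → t ∈ₗ tuples I → 0ℚ ≤ contribution S t
    by-pattern (bin a′ b′)     d t∈I =
      by-binary-pattern d t∈I (binary-patterns (restrict S (a′ ∷ b′ ∷ [])))
    by-pattern (tern a′ b′ c′) d t∈I =
      ℚP.≤-reflexive (sym (contribution-≡0 S _ d (not-ternary t∈I) (place-nonempty i∈ab)))

  contribution-ab-pos : 0ℚ < contribution S (bin a b)
  contribution-ab-pos = contribution-pos S (bin a b) a≢b (λ _ → lookup-place-∉)
    (subst (λ (s : Subset2 2) → 0ℚ < fourierSum prob2ᵛ s) (sym restrict-place) fourierSum-prob2-TT-TF)

  representation : bin b a ∉ₗ tuples I → bin a b ∈ₗ tuples I → ∀ {i} → i ∈ (a ∷ b ∷ []) →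
                   (∀ {t} → t ∈ₗ tuples I → ¬ InTernary i t) → Representation I i
  representation ba∉I ab∈I i∈ab not-ternary =
    S , place-nonempty i∈ab ,
    ghat≢0 I irr S (contribution-nonneg-all ba∉I i∈ab not-ternary) ab∈I contribution-ab-pos

_≟ᵗ_ : ∀ {n} → DecidableEquality (Tuple n)
bin a b    ≟ᵗ bin a′ b′    = map′ (λ { (refl , refl) → refl }) (λ { refl → refl , refl }) (a ≟ a′ ×-dec b ≟ b′)
tern a b c ≟ᵗ tern a′ b′ c′ = map′ (λ { (refl , refl , refl) → refl }) (λ { refl → refl , refl , refl })
                                   (a ≟ a′ ×-dec b ≟ b′ ×-dec c ≟ c′)
bin _ _    ≟ᵗ tern _ _ _   = no λ ()
tern _ _ _ ≟ᵗ bin _ _      = no λ ()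

_∈ᵗ?_ : ∀ {n} (t : Tuple n) (ts : List (Tuple n)) → Dec (t ∈ₗ ts)
t ∈ᵗ? ts = AnyL.any? (t ≟ᵗ_) ts

ternary-choice : (I : Instance) → Irreducible I → ∀ {a b c} → tern a b c ∈ₗ tuples I →
  (tern a c b ∉ₗ tuples I × tern b c a ∉ₗ tuples I) ⊎ (tern b a c ∉ₗ tuples I × tern c a b ∉ₗ tuples I)
ternary-choice I irr {a} {b} {c} abc with tern a c b ∈ᵗ? tuples I | tern b c a ∈ᵗ? tuples I
... | no acb∉ | no bca∉ = inj₁ (acb∉ , bca∉)
... | yes acb | _       =
  inj₂ ((λ bac → noEdgeReplacement a b c abc bac acb) , (λ cab → noEdgeReplacement a c b acb cab abc))
  where open Irreducible irr
... | no _    | yes bca =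
  inj₂ ((λ bac → noEdgeReplacement b a c bac abc bca) , (λ cab → noCycleReplacement a b c abc bca cab))
  where open Irreducible irr

representation-ternary : (I : Instance) → Irreducible I → ∀ {i t} → t ∈ₗ tuples I → InTernary i t →
                         Representation I i
representation-ternary I irr {t = tern a b c} abc∈I i∈abc
  with tuple-distinct I abc∈I | ternary-choice I irr abc∈I
... | a≢b , a≢c , b≢c | inj₁ (acb∉I , bca∉I) =
  representation acb∉I bca∉I abc∈I contribution-xyz-pos i∈abc
  where open TernaryWitness I irr a≢b a≢c b≢c
... | a≢b , a≢c , b≢c | inj₂ (bac∉I , cab∉I) =
  -- FT TT TF on (b, c, a) is TF FT TT on (a, b, c).
  representation bac∉I cab∉I abc∈I contribution-zxy-pos (∈-rotate i∈abc)
  where open TernaryWitness I irr b≢c (≢-sym a≢b) (≢-sym a≢c)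

representation-binary : (I : Instance) → Irreducible I → ∀ {i t} → t ∈ₗ tuples I → Occurs i t →
                        (∀ {t} → t ∈ₗ tuples I → ¬ InTernary i t) → Representation I i
representation-binary I irr {t = bin a b}    ab∈I  i∈ab  not-ternary =
  representation (Irreducible.noCancellation irr a b ab∈I) ab∈I (Occurs⇒∈vars (bin a b) i∈ab) not-ternary
  where open BinaryWitness I irr (tuple-distinct I ab∈I)
representation-binary I irr {t = tern a b c} abc∈I i∈abc not-ternary =
  ⊥-elim (not-ternary abc∈I (Occurs⇒∈vars (tern a b c) i∈abc))

lemma7 : (I : Instance) → Irreducible I → (i : Fin (n I)) →
         ∃[ S ] ((proj₁ (lookup S i) ∨ proj₂ (lookup S i)) ≡ true × ghat I S ≢ 0ℚ)
lemma7 I irr i with AnyL.any? (inTernary? i) (tuples I)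
... | yes in-ternary = let (t , t∈I , i∈t) = find in-ternary in representation-ternary I irr t∈I i∈t
... | no  no-ternary = let (e , e∈I , i∈e) = Irreducible.everyVarOccurs irr i in
  representation-binary I irr (∈ₗ-map⁺ tuple e∈I) i∈e (λ t∈I i∈t → no-ternary (lose t∈I i∈t))
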